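{- Let $P$ be a finite poset and let $\varphi\colon P\to P$ be a map such that $\varphi\circ\varphi=\mathrm{id}_P$ and, for all $x,y\in P$, $x\le y \iff \varphi(x)\le\varphi(y)$. Let $F:=\{x\in P:\varphi(x)=x\}$ be the set of fixed points of $\varphi$, regarded as an induced subposet of $P$. If $F$ is a down set of $P$, then the poset game $P$ is equivalent to the poset game $F$.
   Context: A poset game on a finite poset $P$: two players alternate moves; a move consists of choosing a point $x$ of the remaining poset and removing every $y$ with $x\le y$; the first player unable to move (empty poset) loses. A down set of $P$ is a subset $S\subseteq P$ such that $x\in S$ and $y\le x$ imply $y\in S$. For (finite) combinatorial games, the sum $G+H$ is the game in which each move is a move in exactly one of the components; for poset games this is the poset game on the disjoint (parallel) union of the posets, with no comparabilities between the two parts. Two games $G,H$ are equivalent iff for every game $X$, $G+X$ and $H+X$ have the same outcome (same winner under optimal play for each choice of who moves first). For impartial games such as poset games, $G$ and $H$ are equivalent iff $G+H$ is a second-player win, iff $G$ and $H$ have the same Grundy number. -}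

module Defs where

open import Data.Nat using (ℕ; zero; suc)
open import Data.Bool using (Bool; true; false; not; _∧_; _∨_)
open import Data.Fin using (Fin; _≟_)
open import Data.Fin.Subset using (Subset; _∈_; _∩_; ∁; ⊤)
open import Data.List using (List; []; _∷_; _++_; map; filter; any)
open import Data.List.Base using (allFin)
open import Data.Vec using (tabulate; lookup)
open import Data.Product using (_×_)
open import Relation.Binary.Core using (Rel)
open import Relation.Binary.Definitions using (Decidable)
open import Relation.Binary.Structures using (IsPartialOrder)
open import Relation.Binary.PropositionalEquality using (_≡_)
open import Relation.Nullary.Decidable using (⌊_⌋)

data Game : Set where
  mk : List Game → List Game → Game   -- left options, right options

mutual
  _⊕_ : Game → Game → Game
  g@(mk gl gr) ⊕ h@(mk hl hr) = mk (sumL gl h ++ sumR g hl) (sumL gr h ++ sumR g hr)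

  sumL : List Game → Game → List Game
  sumL []       h = []
  sumL (g ∷ gs) h = (g ⊕ h) ∷ sumL gs h

  sumR : Game → List Game → List Game
  sumR g []       = []
  sumR g (h ∷ hs) = (g ⊕ h) ∷ sumR g hs

-- Normal play: a player unable to move loses.
mutual
  leftWinsFirst : Game → Bool
  leftWinsFirst (mk gl gr) = anyL gl

  rightWinsFirst : Game → Bool
  rightWinsFirst (mk gl gr) = anyR gr

  anyL : List Game → Bool
  anyL []       = false
  anyL (g ∷ gs) = not (rightWinsFirst g) ∨ anyL gs

  anyR : List Game → Bool
  anyR []       = false
  anyR (g ∷ gs) = not (leftWinsFirst g) ∨ anyR gs

SameOutcome : Game → Game → Set
SameOutcome g h = (leftWinsFirst g ≡ leftWinsFirst h) × (rightWinsFirst g ≡ rightWinsFirst h)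

_≈G_ : Game → Game → Set
g ≈G h = (x : Game) → SameOutcome (g ⊕ x) (h ⊕ x)

record FinPoset : Set₁ where
  field
    n              : ℕ
    _≤_            : Rel (Fin n) _
    isPartialOrder : IsPartialOrder _≡_ _≤_
    _≤?_           : Decidable _≤_

module _ (P : FinPoset) where
  open FinPoset P

  upSet : Fin n → Subset n
  upSet x = tabulate (λ y → ⌊ x ≤? y ⌋)

  elems : Subset n → List (Fin n)
  elems S = filter (λ x → lookup S x Data.Bool.≟ true) (allFin n)

  -- Poset game on the induced subposet S of P (fuel k; each move removes
  -- at least one point, so fuel n suffices for all S).
  gameFuel : ℕ → Subset n → Game
  gameFuel zero    S = mk [] []
  gameFuel (suc k) S = mk opts opts
    where opts = map (λ x → gameFuel k (S ∩ ∁ (upSet x))) (elems S)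

  subposetGame : Subset n → Game
  subposetGame S = gameFuel n S

  posetGame : Game
  posetGame = subposetGame ⊤

  IsDownSet : Subset n → Set
  IsDownSet S = ∀ {x y} → y ≤ x → x ∈ S → y ∈ S

  fixedPoints : (Fin n → Fin n) → Subset n
  fixedPoints φ = tabulate (λ x → ⌊ φ x ≟ x ⌋)

-- Pair a φ-stable position S of the game on P with the position S ∩ F of the
-- game on F.  A move at a fixed point x is copied in the other game.  A move at
-- a point x with φ x ≠ x exists only on the P side; it is answered at once by
-- the mirror move φ x, which restores φ-stability and, because F is a down set,
-- leaves S ∩ F untouched.  A pairing of two games in which every move of one
-- game is either copied in the other or immediately reversed makes G + X and
-- H + X have the same outcome for every X.
module Submission where

open import Defs
open import Data.Nat using (ℕ; zero; suc; _+_; _⊔_; _<_; s≤s)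
open import Data.Nat.Properties
  using (≤-trans; <-trans; <-≤-trans; ≤-pred; m≤m⊔n; m≤n⊔m; +-monoˡ-<; +-monoʳ-<; n<1+n)
open import Data.Bool using (Bool; true; false; not; _∨_)
open import Data.Bool.Properties using (∨-zeroʳ; ⇔→≡)
open import Data.Fin using (Fin; _≟_)
open import Data.Fin.Subset using (Subset; _∈_; _∉_; _∩_; ∁; ⊤; ∣_∣)
open import Data.Fin.Subset.Properties
  using (p⊂q⇒∣p∣<∣q∣; p∩q⊆p; x∈p∩q⁺; x∈p∩q⁻; x∈∁p⇒x∉p; x∉p⇒x∈∁p; ∈⊤; ∣p∣≤n;
         ⊆-antisym; ∩-assoc; ∩-comm; ∩-identityˡ)
open import Data.Vec using (tabulate; lookup)
open import Data.Vec.Properties using (lookup∘tabulate; []=⇒lookup; lookup⇒[]=)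
open import Data.List using (List; []; _∷_; _++_; map; allFin)
open import Data.List.Relation.Unary.Any using (here; there)
open import Data.List.Membership.Propositional using () renaming (_∈_ to _∈ᴸ_)
open import Data.List.Membership.Propositional.Properties
  using (∈-map⁺; ∈-map⁻; ∈-++⁺ˡ; ∈-++⁺ʳ; ∈-++⁻; ∈-filter⁺; ∈-filter⁻; ∈-allFin)
open import Data.Product using (_×_; _,_; ∃-syntax; proj₁; proj₂)
open import Data.Sum using (_⊎_; inj₁; inj₂)
import Data.Sum as Sum
open import Relation.Nullary using (¬_; Dec; yes; no; contradiction)
open import Relation.Nullary.Decidable using (⌊_⌋)
open import Relation.Binary.PropositionalEquality
  using (_≡_; _≢_; refl; sym; trans; cong; cong₂; subst; module ≡-Reasoning)
open import Relation.Binary.Structures using (IsPartialOrder)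
open import Function.Bundles using (_⇔_; mk⇔; Equivalence)
open import Function.Construct.Composition using (_⇔-∘_)

data Side : Set where
  left right : Side

opp : Side → Side
opp left  = right
opp right = left

opp-involutive : ∀ s → opp (opp s) ≡ s
opp-involutive left  = refl
opp-involutive right = refl

options : Side → Game → List Game
options left  (mk l r) = l
options right (mk l r) = r

winsFirst : Side → Game → Bool
winsFirst left  = leftWinsFirst
winsFirst right = rightWinsFirst

hasWinningMove : Side → List Game → Bool
hasWinningMove left  = anyL
hasWinningMove right = anyR

winsFirst-options : ∀ s G → winsFirst s G ≡ hasWinningMove s (options s G)
winsFirst-options left  (mk l r) = refl
winsFirst-options right (mk l r) = refl

hasWinningMove-∷ : ∀ s g gs →
  hasWinningMove s (g ∷ gs) ≡ not (winsFirst (opp s) g) ∨ hasWinningMove s gs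
hasWinningMove-∷ left  g gs = refl
hasWinningMove-∷ right g gs = refl

hasWinningMove⁺ : ∀ s {g gs} → g ∈ᴸ gs → winsFirst (opp s) g ≡ false →
  hasWinningMove s gs ≡ true
hasWinningMove⁺ s {g} {_ ∷ gs} (here refl) loses
  rewrite hasWinningMove-∷ s g gs | loses = refl
hasWinningMove⁺ s {gs = g′ ∷ gs} (there g∈gs) loses
  rewrite hasWinningMove-∷ s g′ gs | hasWinningMove⁺ s g∈gs loses = ∨-zeroʳ _

hasWinningMove⁻ : ∀ s gs → hasWinningMove s gs ≡ true →
  ∃[ g ] (g ∈ᴸ gs × winsFirst (opp s) g ≡ false)
hasWinningMove⁻ left  [] ()
hasWinningMove⁻ right [] ()
hasWinningMove⁻ s (g ∷ gs) wins rewrite hasWinningMove-∷ s g gs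
  with winsFirst (opp s) g in loses
... | false = g , here refl , loses
... | true  = let h , h∈gs , h-loses = hasWinningMove⁻ s gs wins in h , there h∈gs , h-loses

winsFirst⁺ : ∀ s {g G} → g ∈ᴸ options s G → winsFirst (opp s) g ≡ false →
  winsFirst s G ≡ true
winsFirst⁺ s {G = G} g∈ loses = trans (winsFirst-options s G) (hasWinningMove⁺ s g∈ loses)

winsFirst⁻ : ∀ s G → winsFirst s G ≡ true →
  ∃[ g ] (g ∈ᴸ options s G × winsFirst (opp s) g ≡ false)
winsFirst⁻ s G wins = hasWinningMove⁻ s (options s G) (trans (sym (winsFirst-options s G)) wins)

winsFirst-option : ∀ s {g G} → g ∈ᴸ options s G → winsFirst s G ≡ false →
  winsFirst (opp s) g ≡ true
winsFirst-option s {g} g∈ loses with winsFirst (opp s) g in g-loses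
... | true  = refl
... | false = trans (sym loses) (winsFirst⁺ s g∈ g-loses)

sumL-map : ∀ gs h → sumL gs h ≡ map (_⊕ h) gs
sumL-map []       h = refl
sumL-map (g ∷ gs) h = cong (g ⊕ h ∷_) (sumL-map gs h)

sumR-map : ∀ g hs → sumR g hs ≡ map (g ⊕_) hs
sumR-map g []       = refl
sumR-map g (h ∷ hs) = cong (g ⊕ h ∷_) (sumR-map g hs)

options-⊕ : ∀ s A X → options s (A ⊕ X) ≡ map (_⊕ X) (options s A) ++ map (A ⊕_) (options s X)
options-⊕ left  A@(mk al ar) X@(mk xl xr) = cong₂ _++_ (sumL-map al X) (sumR-map A xl)
options-⊕ right A@(mk al ar) X@(mk xl xr) = cong₂ _++_ (sumL-map ar X) (sumR-map A xr)

⊕-optionˡ : ∀ s {a A} X → a ∈ᴸ options s A → a ⊕ X ∈ᴸ options s (A ⊕ X)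
⊕-optionˡ s {A = A} X a∈ = subst (_ ∈ᴸ_) (sym (options-⊕ s A X)) (∈-++⁺ˡ (∈-map⁺ (_⊕ X) a∈))

⊕-optionʳ : ∀ s A {x X} → x ∈ᴸ options s X → A ⊕ x ∈ᴸ options s (A ⊕ X)
⊕-optionʳ s A {X = X} x∈ =
  subst (_ ∈ᴸ_) (sym (options-⊕ s A X)) (∈-++⁺ʳ _ (∈-map⁺ (A ⊕_) x∈))

⊕-option⁻ : ∀ s A X {g} → g ∈ᴸ options s (A ⊕ X) →
  (∃[ a ] (a ∈ᴸ options s A × g ≡ a ⊕ X)) ⊎ (∃[ x ] (x ∈ᴸ options s X × g ≡ A ⊕ x))
⊕-option⁻ s A X g∈ =
  Sum.map (∈-map⁻ (_⊕ X)) (∈-map⁻ (A ⊕_)) (∈-++⁻ _ (subst (_ ∈ᴸ_) (options-⊕ s A X) g∈))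

mutual
  height : Game → ℕ
  height (mk l r) = suc (maxHeight l ⊔ maxHeight r)

  maxHeight : List Game → ℕ
  maxHeight []       = 0
  maxHeight (g ∷ gs) = height g ⊔ maxHeight gs

height≤maxHeight : ∀ {g gs} → g ∈ᴸ gs → height g Data.Nat.≤ maxHeight gs
height≤maxHeight {gs = g ∷ gs}  (here refl)  = m≤m⊔n _ _
height≤maxHeight {gs = g′ ∷ gs} (there g∈gs) = ≤-trans (height≤maxHeight g∈gs) (m≤n⊔m (height g′) _)

height-option : ∀ s {g G} → g ∈ᴸ options s G → height g < height G
height-option left  {G = mk l r} g∈ = s≤s (≤-trans (height≤maxHeight g∈) (m≤m⊔n _ (maxHeight r)))
height-option right {G = mk l r} g∈ = s≤s (≤-trans (height≤maxHeight g∈) (m≤n⊔m (maxHeight l) _))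

record Mirroring (_∼_ : Game → Game → Set) : Set where
  field
    copy   : ∀ {A B} → A ∼ B → ∀ s {b} → b ∈ᴸ options s B →
             ∃[ a ] (a ∈ᴸ options s A × a ∼ b)
    answer : ∀ {A B} → A ∼ B → ∀ s {a} → a ∈ᴸ options s A →
             (∃[ b ] (b ∈ᴸ options s B × a ∼ b)) ⊎ (∃[ c ] (c ∈ᴸ options (opp s) a × c ∼ B))

module _ {_∼_ : Game → Game → Set} (M : Mirroring _∼_) where
  open Mirroring M

  mirroring-winsFirst : ∀ k {A B X} → height A + height X < k → A ∼ B →
    ∀ s → winsFirst s (A ⊕ X) ≡ winsFirst s (B ⊕ X)
  mirroring-winsFirst (suc k) {A} {B} {X} (s≤s bound) A∼B s =
    ⇔→≡ (mk⇔ forward backward)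
    where
    ih-left : ∀ {A′ B′} → height A′ < height A → A′ ∼ B′ →
      ∀ t → winsFirst t (A′ ⊕ X) ≡ winsFirst t (B′ ⊕ X)
    ih-left lt = mirroring-winsFirst k (<-≤-trans (+-monoˡ-< (height X) lt) bound)

    ih-right : ∀ t {x} → x ∈ᴸ options t X → ∀ t′ → winsFirst t′ (A ⊕ x) ≡ winsFirst t′ (B ⊕ x)
    ih-right t x∈ =
      mirroring-winsFirst k (<-≤-trans (+-monoʳ-< (height A) (height-option t x∈)) bound) A∼B

    forward : winsFirst s (A ⊕ X) ≡ true → winsFirst s (B ⊕ X) ≡ true
    forward wins with winsFirst⁻ s (A ⊕ X) wins
    ... | g , g∈ , g-loses with ⊕-option⁻ s A X g∈
    ... | inj₂ (x , x∈ , refl) =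
      winsFirst⁺ s (⊕-optionʳ s B x∈) (trans (sym (ih-right s x∈ (opp s))) g-loses)
    ... | inj₁ (a , a∈ , refl) with answer A∼B s a∈
    ...   | inj₁ (b , b∈ , a∼b) =
      winsFirst⁺ s (⊕-optionˡ s X b∈) (trans (sym (ih-left (height-option s a∈) a∼b (opp s))) g-loses)
    ...   | inj₂ (c , c∈ , c∼B) = trans (sym (ih-left c<A c∼B s)) c⊕X-wins
      where
      c<A : height c < height A
      c<A = <-trans (height-option (opp s) c∈) (height-option s a∈)
      c⊕X-wins : winsFirst s (c ⊕ X) ≡ true
      c⊕X-wins = subst (λ t → winsFirst t (c ⊕ X) ≡ true) (opp-involutive s)
                   (winsFirst-option (opp s) (⊕-optionˡ (opp s) X c∈) g-loses)

    backward : winsFirst s (B ⊕ X) ≡ true → winsFirst s (A ⊕ X) ≡ true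
    backward wins with winsFirst⁻ s (B ⊕ X) wins
    ... | g , g∈ , g-loses with ⊕-option⁻ s B X g∈
    ... | inj₂ (x , x∈ , refl) =
      winsFirst⁺ s (⊕-optionʳ s A x∈) (trans (ih-right s x∈ (opp s)) g-loses)
    ... | inj₁ (b , b∈ , refl) with copy A∼B s b∈
    ...   | a , a∈ , a∼b =
      winsFirst⁺ s (⊕-optionˡ s X a∈) (trans (ih-left (height-option s a∈) a∼b (opp s)) g-loses)

  mirroring⇒≈G : ∀ {A B} → A ∼ B → A ≈G B
  mirroring⇒≈G {A} A∼B X = sameSide left , sameSide right
    where
    sameSide : ∀ s → winsFirst s (A ⊕ X) ≡ winsFirst s (_ ⊕ X)
    sameSide = mirroring-winsFirst (suc (height A + height X)) (n<1+n _) A∼B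

∈-tabulate : ∀ {n} {f : Fin n → Bool} {y} → y ∈ tabulate f ⇔ f y ≡ true
∈-tabulate {f = f} {y} = mk⇔
  (λ y∈ → trans (sym (lookup∘tabulate f y)) ([]=⇒lookup y∈))
  (λ fy → lookup⇒[]= y (tabulate f) (trans (lookup∘tabulate f y) fy))

⌊⌋≡true⇔ : ∀ {p} {Q : Set p} (d : Dec Q) → ⌊ d ⌋ ≡ true ⇔ Q
⌊⌋≡true⇔ (yes q) = mk⇔ (λ _ → q) (λ _ → refl)
⌊⌋≡true⇔ (no ¬q) = mk⇔ (λ ()) (λ q → contradiction q ¬q)

options-impartial : ∀ s gs → options s (mk gs gs) ≡ gs
options-impartial left  gs = refl
options-impartial right gs = refl

module PosetGame (P : FinPoset) where
  open FinPoset P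
  open IsPartialOrder isPartialOrder using () renaming (refl to ≤-refl)

  _∖↑_ : Subset n → Fin n → Subset n
  S ∖↑ x = S ∩ ∁ (upSet P x)

  ∈-upSet : ∀ {x y} → y ∈ upSet P x ⇔ x ≤ y
  ∈-upSet {x} {y} = ⌊⌋≡true⇔ (x ≤? y) ⇔-∘ ∈-tabulate

  ∈-∖↑⁺ : ∀ {S x y} → y ∈ S → ¬ x ≤ y → y ∈ S ∖↑ x
  ∈-∖↑⁺ y∈S x≰y = x∈p∩q⁺ (y∈S , x∉p⇒x∈∁p (λ y∈↑x → x≰y (Equivalence.to ∈-upSet y∈↑x)))

  ∈-∖↑⁻ : ∀ {S x y} → y ∈ S ∖↑ x → y ∈ S × ¬ x ≤ y
  ∈-∖↑⁻ {S} {x} y∈ =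
    let y∈S , y∈∁↑x = x∈p∩q⁻ S _ y∈
    in y∈S , λ x≤y → x∈∁p⇒x∉p y∈∁↑x (Equivalence.from ∈-upSet x≤y)

  ∣∖↑∣<∣∣ : ∀ {S x} → x ∈ S → ∣ S ∖↑ x ∣ < ∣ S ∣
  ∣∖↑∣<∣∣ {S} x∈S = p⊂q⇒∣p∣<∣q∣ (p∩q⊆p S _ , _ , x∈S , λ x∈ → proj₂ (∈-∖↑⁻ x∈) ≤-refl)

  ∈-elems : ∀ {S x} → x ∈ᴸ elems P S ⇔ x ∈ S
  ∈-elems {S} {x} = mk⇔
    (λ x∈ → lookup⇒[]= x S (proj₂ (∈-filter⁻ inS? {xs = allFin n} x∈)))
    (λ x∈ → ∈-filter⁺ inS? (∈-allFin x) ([]=⇒lookup x∈))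
    where inS? = λ y → lookup S y Data.Bool.≟ true

  -- G is the poset game on S: fuel k ≥ ∣ S ∣ never runs out, as every move removes a point.
  data IsGameOn (S : Subset n) : Game → Set where
    gameOn : ∀ {k} → ∣ S ∣ Data.Nat.≤ k → IsGameOn S (gameFuel P k S)

  isGameOn-subst : ∀ {S T G} → S ≡ T → IsGameOn S G → IsGameOn T G
  isGameOn-subst {G = G} = subst (λ T → IsGameOn T G)

  isGameOn-option⁻ : ∀ s {S G g} → IsGameOn S G → g ∈ᴸ options s G →
    ∃[ x ] (x ∈ S × IsGameOn (S ∖↑ x) g)
  isGameOn-option⁻ left  (gameOn {zero} _) ()
  isGameOn-option⁻ right (gameOn {zero} _) ()
  isGameOn-option⁻ s {S} (gameOn {suc k} bound) g∈
    with ∈-map⁻ (λ x → gameFuel P k (S ∖↑ x)) (subst (_ ∈ᴸ_) (options-impartial s _) g∈)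
  ... | x , x∈ , refl =
    x , x∈S , gameOn (≤-pred (<-≤-trans (∣∖↑∣<∣∣ x∈S) bound))
    where x∈S = Equivalence.to ∈-elems x∈

  isGameOn-option⁺ : ∀ s {S G x} → IsGameOn S G → x ∈ S →
    ∃[ g ] (g ∈ᴸ options s G × IsGameOn (S ∖↑ x) g)
  isGameOn-option⁺ s (gameOn {zero} bound) x∈S with () ← <-≤-trans (∣∖↑∣<∣∣ x∈S) bound
  isGameOn-option⁺ s {S} {x = x} (gameOn {suc k} bound) x∈S =
    gameFuel P k (S ∖↑ x) ,
    subst (_ ∈ᴸ_) (sym (options-impartial s _))
      (∈-map⁺ (λ y → gameFuel P k (S ∖↑ y)) (Equivalence.from ∈-elems x∈S)) ,
    gameOn (≤-pred (<-≤-trans (∣∖↑∣<∣∣ x∈S) bound))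

  ∩-∖↑-comm : ∀ S D x → (S ∩ D) ∖↑ x ≡ (S ∖↑ x) ∩ D
  ∩-∖↑-comm S D x = begin
    (S ∩ D) ∩ ∁↑x   ≡⟨ ∩-assoc S D ∁↑x ⟩
    S ∩ (D ∩ ∁↑x)   ≡⟨ cong (S ∩_) (∩-comm D ∁↑x) ⟩
    S ∩ (∁↑x ∩ D)   ≡⟨ ∩-assoc S ∁↑x D ⟨
    (S ∩ ∁↑x) ∩ D   ∎
    where
    open ≡-Reasoning
    ∁↑x = ∁ (upSet P x)

  ∖↑-∩-downSet : ∀ S {D x} → IsDownSet P D → x ∉ D → (S ∖↑ x) ∩ D ≡ S ∩ D
  ∖↑-∩-downSet S {D} down x∉D = ⊆-antisym
    (λ y∈ → let y∈S∖↑x , y∈D = x∈p∩q⁻ _ D y∈ in x∈p∩q⁺ (proj₁ (∈-∖↑⁻ y∈S∖↑x) , y∈D))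
    (λ y∈ → let y∈S , y∈D = x∈p∩q⁻ S D y∈
            in x∈p∩q⁺ (∈-∖↑⁺ y∈S (λ x≤y → x∉D (down x≤y y∈D)) , y∈D))

module FixedPoints (P : FinPoset) (φ : Fin (FinPoset.n P) → Fin (FinPoset.n P))
  (φ-involutive : ∀ x → φ (φ x) ≡ x)
  (φ-order : ∀ x y → (FinPoset._≤_ P x y ⇔ FinPoset._≤_ P (φ x) (φ y)))
  (F-down : IsDownSet P (fixedPoints P φ)) where

  open FinPoset P
  open PosetGame P
  open IsPartialOrder isPartialOrder using () renaming (antisym to ≤-antisym)

  F : Subset n
  F = fixedPoints P φ

  ∈-F : ∀ {y} → y ∈ F ⇔ φ y ≡ y
  ∈-F {y} = ⌊⌋≡true⇔ (φ y ≟ y) ⇔-∘ ∈-tabulate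

  φ-transpose : ∀ {x y} → x ≤ φ y → φ x ≤ y
  φ-transpose {x} {y} x≤φy =
    subst (φ x ≤_) (φ-involutive y) (Equivalence.to (φ-order x (φ y)) x≤φy)

  Invariant : Subset n → Set
  Invariant S = ∀ {y} → y ∈ S → φ y ∈ S

  ∖↑-invariant : ∀ {S x} → φ x ≡ x → Invariant S → Invariant (S ∖↑ x)
  ∖↑-invariant {x = x} φx≡x inv y∈ =
    let y∈S , x≰y = ∈-∖↑⁻ y∈
    in ∈-∖↑⁺ (inv y∈S) (λ x≤φy → x≰y (subst (_≤ _) φx≡x (φ-transpose x≤φy)))

  ∖↑∖↑φ-invariant : ∀ {S x} → Invariant S → Invariant ((S ∖↑ x) ∖↑ φ x)
  ∖↑∖↑φ-invariant {x = x} inv y∈ =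
    let y∈S∖↑x , φx≰y = ∈-∖↑⁻ y∈
        y∈S , x≰y = ∈-∖↑⁻ y∈S∖↑x
    in ∈-∖↑⁺ (∈-∖↑⁺ (inv y∈S) (λ x≤φy → φx≰y (φ-transpose x≤φy)))
             (λ φx≤φy → x≰y (Equivalence.from (φ-order x _) φx≤φy))

  φ-∈-∖↑ : ∀ {S x} → Invariant S → x ∈ S → φ x ≢ x → φ x ∈ S ∖↑ x
  φ-∈-∖↑ inv x∈S φx≢x = ∈-∖↑⁺ (inv x∈S) (λ x≤φx → φx≢x (≤-antisym (φ-transpose x≤φx) x≤φx))

  ∖↑∖↑φ-∩-F : ∀ S {x} → φ x ≢ x → ((S ∖↑ x) ∖↑ φ x) ∩ F ≡ S ∩ F
  ∖↑∖↑φ-∩-F S {x} φx≢x =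
    trans (∖↑-∩-downSet (S ∖↑ x) F-down φx∉F) (∖↑-∩-downSet S F-down x∉F)
    where
    x∉F : x ∉ F
    x∉F x∈F = φx≢x (Equivalence.to ∈-F x∈F)
    φx∉F : φ x ∉ F
    φx∉F φx∈F = φx≢x (trans (sym (Equivalence.to ∈-F φx∈F)) (φ-involutive x))

  data Mirrored : Game → Game → Set where
    mirrored : ∀ {S G H} → Invariant S → IsGameOn S G → IsGameOn (S ∩ F) H → Mirrored G H

  mirroring : Mirroring Mirrored
  mirroring = record { copy = copy ; answer = answer }
    where
    copy : ∀ {A B} → Mirrored A B → ∀ s {b} → b ∈ᴸ options s B →
           ∃[ a ] (a ∈ᴸ options s A × Mirrored a b)
    copy (mirrored {S} inv A-on B-on) s b∈ with isGameOn-option⁻ s B-on b∈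
    ... | x , x∈S∩F , b-on with x∈p∩q⁻ S F x∈S∩F
    ...   | x∈S , x∈F with isGameOn-option⁺ s A-on x∈S
    ...     | a , a∈ , a-on =
      a , a∈ , mirrored (∖↑-invariant (Equivalence.to ∈-F x∈F) inv) a-on
                 (isGameOn-subst (∩-∖↑-comm S F x) b-on)

    answer : ∀ {A B} → Mirrored A B → ∀ s {a} → a ∈ᴸ options s A →
             (∃[ b ] (b ∈ᴸ options s B × Mirrored a b)) ⊎
             (∃[ c ] (c ∈ᴸ options (opp s) a × Mirrored c B))
    answer (mirrored {S} inv A-on B-on) s a∈ with isGameOn-option⁻ s A-on a∈
    ... | x , x∈S , a-on with φ x ≟ x
    ...   | yes φx≡x =
      let b , b∈ , b-on = isGameOn-option⁺ s B-on (x∈p∩q⁺ (x∈S , Equivalence.from ∈-F φx≡x))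
      in inj₁ (b , b∈ , mirrored (∖↑-invariant φx≡x inv) a-on
                          (isGameOn-subst (∩-∖↑-comm S F x) b-on))
    ...   | no φx≢x =
      let c , c∈ , c-on = isGameOn-option⁺ (opp s) a-on (φ-∈-∖↑ inv x∈S φx≢x)
      in inj₂ (c , c∈ , mirrored (∖↑∖↑φ-invariant inv) c-on
                          (isGameOn-subst (sym (∖↑∖↑φ-∩-F S φx≢x)) B-on))

  posetGame-mirrored : Mirrored (posetGame P) (subposetGame P F)
  posetGame-mirrored = mirrored (λ _ → ∈⊤) (gameOn (∣p∣≤n ⊤))
    (isGameOn-subst (sym (∩-identityˡ F)) (gameOn (∣p∣≤n F)))

mainTheorem1 : (P : FinPoset) (φ : Fin (FinPoset.n P) → Fin (FinPoset.n P)) →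
    (∀ x → φ (φ x) ≡ x) →
    (∀ x y → (FinPoset._≤_ P x y ⇔ FinPoset._≤_ P (φ x) (φ y))) →
    IsDownSet P (fixedPoints P φ) →
    posetGame P ≈G subposetGame P (fixedPoints P φ)
mainTheorem1 P φ φ-involutive φ-order F-down = mirroring⇒≈G mirroring posetGame-mirrored
  where open FixedPoints P φ φ-involutive φ-order F-down
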